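{- Let $k\geq 1$ and let $A,B\subseteq \mathbb{Z}_{2k}$ with $|A|=|B|=k$. Suppose $A$ has doubling constant $\delta(A)=2$, i.e. $|A+A|=2|A|=2k$. Then \[ \max\{|A+B|,\,|A-B|\}\geq \sqrt{2}\,k . \]
   Context: For subsets $U,V$ of $\mathbb{Z}_{2k}$, $U+V=\{u+v: u\in U, v\in V\}$ and $U-V=\{u-v:u\in U,v\in V\}$. The doubling constant of $U$ is $\delta(U)=|U+U|/|U|$ (equivalently $\exp(d(U,-U))$ for the Ruzsa distance $d(U,V)=\log\frac{|U-V|}{\sqrt{|U||V|}}$). -}

module Defs where

open import Data.Nat using (ℕ; zero; suc; _+_; _∸_; _%_)
open import Data.Nat.DivMod using (m%n<n)
open import Data.Fin using (Fin; toℕ; fromℕ<) renaming (_≟_ to _≟ᶠ_)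
open import Data.Fin.Subset using (Subset; _∈_)
open import Data.Fin.Subset.Properties using (_∈?_)
open import Data.Fin.Properties using (any?)
open import Data.Vec using (tabulate)
open import Data.Product using (∃; _×_; _,_)
open import Relation.Nullary using (Dec; does)
open import Relation.Nullary.Decidable using (_×-dec_)
open import Relation.Binary.PropositionalEquality using (_≡_)

-- Arithmetic in the cyclic group ℤ_n, elements represented by Fin n = {0,…,n-1}.
_⊕_ : ∀ {n} → Fin n → Fin n → Fin n
_⊕_ {suc m} i j = fromℕ< (m%n<n (toℕ i + toℕ j) (suc m))

_⊖_ : ∀ {n} → Fin n → Fin n → Fin n
_⊖_ {suc m} i j = fromℕ< (m%n<n (toℕ i + (suc m ∸ toℕ j)) (suc m))

sumset : ∀ {n} → Subset n → Subset n → Subset n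
sumset U V = tabulate λ x →
  does (any? λ u → any? λ v → (u ∈? U ×-dec v ∈? V) ×-dec (x ≟ᶠ (u ⊕ v)))

diffset : ∀ {n} → Subset n → Subset n → Subset n
diffset U V = tabulate λ x →
  does (any? λ u → any? λ v → (u ∈? U ×-dec v ∈? V) ×-dec (x ≟ᶠ (u ⊖ v)))

module Submission where

open import Defs
open import Data.Nat using (ℕ; _*_; _≤_; _⊔_)
open import Data.Fin.Subset using (Subset; ∣_∣)
open import Relation.Binary.PropositionalEquality using (_≡_)

open import Data.Nat using (zero; suc; _+_; _∸_; _%_; _<_; z≤n; s≤s; _≤?_)
open import Data.Nat.Properties
open import Data.Nat.DivMod using (%-distribˡ-+; m%n%n≡m%n; [m+n]%n≡m%n; m<n⇒m%n≡m)
open import Data.Nat.Solver using (module +-*-Solver)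
open import Data.Bool using (Bool; true; false; _∨_; _∧_; not)
open import Data.Bool.Properties using (not-injective) renaming (_≟_ to _≟ᵇ_)
open import Data.Fin using (Fin; zero; suc; toℕ)
open import Data.Fin.Properties using (toℕ-fromℕ<; toℕ-injective; toℕ<n; toℕ≤n; all?; any?)
  renaming (_≟_ to _≟ᶠ_)
open import Data.Fin.Subset using (_∈_)
open import Data.Fin.Subset.Properties using (_∈?_)
open import Data.Fin.Permutation using (permutation)
open import Data.Vec using ([]; _∷_; lookup)
open import Data.Vec.Properties using (lookup∘tabulate; lookup⇒[]=; []=⇒lookup)
open import Data.Product using (∃; _,_; _×_; proj₁; proj₂; map₂)
open import Data.Empty using (⊥-elim)
open import Relation.Nullary using (Dec; yes; no; does)
open import Relation.Nullary.Decidable using (dec-true; _×-dec_)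
open import Relation.Binary.PropositionalEquality
  using (refl; sym; trans; cong; cong₂; subst; subst₂; module ≡-Reasoning)
import Algebra.Properties.CommutativeMonoid.Sum as MonoidSum

-- Let N = 2k and A, B ⊆ ℤ_N with |A| = |B| = k and |A + A| = 2k = N. We prove the stronger
-- bound |A + B| ≥ 3k/2; then |A + B|² ≥ 9k²/4 ≥ 2k².
--
-- Suppose 2|A + B| < 3k, so more than k/2 elements x are non-sums (x ∉ A + B). For such x the
-- set B is disjoint from the reflection x − A while |B| + |x − A| = N, so B is exactly the
-- complement of x − A. Two non-sums x, x₀ therefore give x − A = x₀ − A, i.e. x − x₀ is a
-- period of A (A + (x − x₀) = A), and A has more than k/2 = |A|/2 periods. For a, a′ ∈ A the
-- cosets a + P and a′ + P of the period group P both lie in A, so they meet and a′ − a ∈ P.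
-- Hence A + A = A + a has only k < 2k elements, a contradiction.

module _ {m : ℕ} where
  private
    N : ℕ
    N = suc m
    open ≡-Reasoning

  %-absorbˡ : ∀ x y → (x % N + y) % N ≡ (x + y) % N
  %-absorbˡ x y = begin
    (x % N + y) % N            ≡⟨ %-distribˡ-+ (x % N) y N ⟩
    (x % N % N + y % N) % N    ≡⟨ cong (λ r → (r + y % N) % N) (m%n%n≡m%n x N) ⟩
    (x % N + y % N) % N        ≡⟨ %-distribˡ-+ x y N ⟨
    (x + y) % N                ∎

  toℕ-⊕ : (x y : Fin N) → toℕ (x ⊕ y) ≡ (toℕ x + toℕ y) % N
  toℕ-⊕ x y = toℕ-fromℕ< _

  toℕ-⊖ : (x y : Fin N) → toℕ (x ⊖ y) ≡ (toℕ x + (N ∸ toℕ y)) % N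
  toℕ-⊖ x y = toℕ-fromℕ< _

  +N-% : (x : Fin N) → ∀ r → r ≡ N → (toℕ x + r) % N ≡ toℕ x
  +N-% x r refl = trans ([m+n]%n≡m%n (toℕ x) N) (m<n⇒m%n≡m (toℕ<n x))

  ⊕-comm : (x y : Fin N) → x ⊕ y ≡ y ⊕ x
  ⊕-comm x y = toℕ-injective (begin
    toℕ (x ⊕ y)               ≡⟨ toℕ-⊕ x y ⟩
    (toℕ x + toℕ y) % N       ≡⟨ cong (_% N) (+-comm (toℕ x) (toℕ y)) ⟩
    (toℕ y + toℕ x) % N       ≡⟨ toℕ-⊕ y x ⟨
    toℕ (y ⊕ x)               ∎)

  ⊕-assoc : (x y z : Fin N) → (x ⊕ y) ⊕ z ≡ x ⊕ (y ⊕ z)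
  ⊕-assoc x y z = toℕ-injective (begin
    toℕ ((x ⊕ y) ⊕ z)                   ≡⟨ toℕ-⊕ (x ⊕ y) z ⟩
    (toℕ (x ⊕ y) + toℕ z) % N           ≡⟨ cong (λ r → (r + toℕ z) % N) (toℕ-⊕ x y) ⟩
    ((toℕ x + toℕ y) % N + toℕ z) % N   ≡⟨ %-absorbˡ (toℕ x + toℕ y) (toℕ z) ⟩
    (toℕ x + toℕ y + toℕ z) % N         ≡⟨ cong (_% N) (+-assoc (toℕ x) (toℕ y) (toℕ z)) ⟩
    (toℕ x + (toℕ y + toℕ z)) % N       ≡⟨ cong (_% N) (+-comm (toℕ x) (toℕ y + toℕ z)) ⟩
    (toℕ y + toℕ z + toℕ x) % N         ≡⟨ %-absorbˡ (toℕ y + toℕ z) (toℕ x) ⟨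
    ((toℕ y + toℕ z) % N + toℕ x) % N   ≡⟨ cong (λ r → (r + toℕ x) % N) (toℕ-⊕ y z) ⟨
    (toℕ (y ⊕ z) + toℕ x) % N           ≡⟨ cong (_% N) (+-comm (toℕ (y ⊕ z)) (toℕ x)) ⟩
    (toℕ x + toℕ (y ⊕ z)) % N           ≡⟨ toℕ-⊕ x (y ⊕ z) ⟨
    toℕ (x ⊕ (y ⊕ z))                   ∎)

  ⊖-⊕ : (x y : Fin N) → (x ⊖ y) ⊕ y ≡ x
  ⊖-⊕ x y = toℕ-injective (begin
    toℕ ((x ⊖ y) ⊕ y)                            ≡⟨ toℕ-⊕ (x ⊖ y) y ⟩
    (toℕ (x ⊖ y) + toℕ y) % N                    ≡⟨ cong (λ r → (r + toℕ y) % N) (toℕ-⊖ x y) ⟩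
    ((toℕ x + (N ∸ toℕ y)) % N + toℕ y) % N      ≡⟨ %-absorbˡ (toℕ x + (N ∸ toℕ y)) (toℕ y) ⟩
    (toℕ x + (N ∸ toℕ y) + toℕ y) % N            ≡⟨ cong (_% N) (+-assoc (toℕ x) (N ∸ toℕ y) (toℕ y)) ⟩
    (toℕ x + ((N ∸ toℕ y) + toℕ y)) % N          ≡⟨ +N-% x _ (m∸n+n≡m (toℕ≤n y)) ⟩
    toℕ x                                        ∎)

  ⊕-⊖ : (x y : Fin N) → (x ⊕ y) ⊖ y ≡ x
  ⊕-⊖ x y = toℕ-injective (begin
    toℕ ((x ⊕ y) ⊖ y)                            ≡⟨ toℕ-⊖ (x ⊕ y) y ⟩
    (toℕ (x ⊕ y) + (N ∸ toℕ y)) % N              ≡⟨ cong (λ r → (r + (N ∸ toℕ y)) % N) (toℕ-⊕ x y) ⟩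
    ((toℕ x + toℕ y) % N + (N ∸ toℕ y)) % N      ≡⟨ %-absorbˡ (toℕ x + toℕ y) (N ∸ toℕ y) ⟩
    (toℕ x + toℕ y + (N ∸ toℕ y)) % N            ≡⟨ cong (_% N) (+-assoc (toℕ x) (toℕ y) (N ∸ toℕ y)) ⟩
    (toℕ x + (toℕ y + (N ∸ toℕ y))) % N          ≡⟨ +N-% x _ (m+[n∸m]≡n (toℕ≤n y)) ⟩
    toℕ x                                        ∎)

  ⊕-⊖′ : (x y : Fin N) → y ⊕ (x ⊖ y) ≡ x
  ⊕-⊖′ x y = trans (⊕-comm y (x ⊖ y)) (⊖-⊕ x y)

  -- x ⊖ y is the unique z with z ⊕ y ≡ x; every identity about ⊖ below reduces to one about ⊕.
  ⊖-unique : {x y z : Fin N} → z ⊕ y ≡ x → x ⊖ y ≡ z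
  ⊖-unique {y = y} {z} refl = ⊕-⊖ z y

  ⊕-rotate : (p q r : Fin N) → (p ⊕ q) ⊕ r ≡ (p ⊕ r) ⊕ q
  ⊕-rotate p q r = begin
    (p ⊕ q) ⊕ r    ≡⟨ ⊕-assoc p q r ⟩
    p ⊕ (q ⊕ r)    ≡⟨ cong (p ⊕_) (⊕-comm q r) ⟩
    p ⊕ (r ⊕ q)    ≡⟨ ⊕-assoc p r q ⟨
    (p ⊕ r) ⊕ q    ∎

  ⊖-involutive : (x y : Fin N) → x ⊖ (x ⊖ y) ≡ y
  ⊖-involutive x y = ⊖-unique (⊕-⊖′ x y)

  ⊖-⊖-shift : (x x₀ z : Fin N) → x ⊖ (x₀ ⊖ z) ≡ z ⊕ (x ⊖ x₀)
  ⊖-⊖-shift x x₀ z = ⊖-unique (begin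
    (z ⊕ (x ⊖ x₀)) ⊕ (x₀ ⊖ z)   ≡⟨ ⊕-rotate z (x ⊖ x₀) (x₀ ⊖ z) ⟩
    (z ⊕ (x₀ ⊖ z)) ⊕ (x ⊖ x₀)   ≡⟨ cong (_⊕ (x ⊖ x₀)) (⊕-⊖′ x₀ z) ⟩
    x₀ ⊕ (x ⊖ x₀)               ≡⟨ ⊕-⊖′ x x₀ ⟩
    x                           ∎)

  ⊖-⊖-cancel : (y a a′ : Fin N) → (y ⊖ a) ⊖ (y ⊖ a′) ≡ a′ ⊖ a
  ⊖-⊖-cancel y a a′ = ⊖-unique (sym (⊖-unique (begin
    ((a′ ⊖ a) ⊕ (y ⊖ a′)) ⊕ a   ≡⟨ ⊕-rotate (a′ ⊖ a) (y ⊖ a′) a ⟩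
    ((a′ ⊖ a) ⊕ a) ⊕ (y ⊖ a′)   ≡⟨ cong (_⊕ (y ⊖ a′)) (⊖-⊕ a′ a) ⟩
    a′ ⊕ (y ⊖ a′)               ≡⟨ ⊕-⊖′ y a′ ⟩
    y                           ∎)))

  ⊕-⊖-assoc : (u v a : Fin N) → (u ⊕ v) ⊖ a ≡ u ⊕ (v ⊖ a)
  ⊕-⊖-assoc u v a = ⊖-unique (trans (⊕-assoc u (v ⊖ a) a) (cong (u ⊕_) (⊖-⊕ v a)))

open MonoidSum +-0-commutativeMonoid using (sum; sum-permute; sum-replicate-zero)

indicator : Bool → ℕ
indicator true  = 1
indicator false = 0

count : ∀ {n} → (Fin n → Bool) → ℕ
count f = sum (λ i → indicator (f i))

∣∣≡count : ∀ {n} (S : Subset n) → ∣ S ∣ ≡ count (lookup S)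
∣∣≡count []          = refl
∣∣≡count (true ∷ S)  = cong suc (∣∣≡count S)
∣∣≡count (false ∷ S) = ∣∣≡count S

count≤n : ∀ {n} (f : Fin n → Bool) → count f ≤ n
count≤n {zero}  f = z≤n
count≤n {suc n} f with f zero
... | true  = s≤s (count≤n (λ i → f (suc i)))
... | false = m≤n⇒m≤1+n (count≤n (λ i → f (suc i)))

count-mono : ∀ {n} (f g : Fin n → Bool) → (∀ x → f x ≡ true → g x ≡ true) → count f ≤ count g
count-mono {zero}  f g f⊆g = z≤n
count-mono {suc n} f g f⊆g with f zero | g zero | f⊆g zero
... | true  | true  | _   = s≤s (count-mono _ _ (λ x → f⊆g (suc x)))
... | true  | false | 0∉g with () ← 0∉g refl
... | false | true  | _   = m≤n⇒m≤1+n (count-mono _ _ (λ x → f⊆g (suc x)))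
... | false | false | _   = count-mono _ _ (λ x → f⊆g (suc x))

count-permute : ∀ {n} (f : Fin n → Bool) (σ τ : Fin n → Fin n) →
  (∀ y → σ (τ y) ≡ y) → (∀ x → τ (σ x) ≡ x) → count (λ x → f (σ x)) ≡ count f
count-permute f σ τ στ τσ = sym (sum-permute (λ i → indicator (f i)) (permutation σ τ στ τσ))

count-embed : ∀ {n} (f g : Fin n → Bool) (σ τ : Fin n → Fin n) →
  (∀ y → σ (τ y) ≡ y) → (∀ x → τ (σ x) ≡ x) →
  (∀ x → f x ≡ true → g (σ x) ≡ true) → count f ≤ count g
count-embed f g σ τ στ τσ f⊆g∘σ =
  ≤-trans (count-mono f (λ x → g (σ x)) f⊆g∘σ) (≤-reflexive (count-permute g σ τ στ τσ))

count-∨-∧ : ∀ {n} (f g : Fin n → Bool) → count f + count g ≡ count (λ x → f x ∨ g x) + count (λ x → f x ∧ g x)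
count-∨-∧ {zero}  f g = refl
count-∨-∧ {suc n} f g with f zero | g zero | count-∨-∧ (λ i → f (suc i)) (λ i → g (suc i))
... | true  | true  | ih = cong suc (trans (+-suc _ _) (trans (cong suc ih) (sym (+-suc _ _))))
... | true  | false | ih = cong suc ih
... | false | true  | ih = trans (+-suc _ _) (cong suc ih)
... | false | false | ih = ih

count-complement : ∀ {n} (f : Fin n → Bool) → count f + count (λ x → not (f x)) ≡ n
count-complement {zero}  f = refl
count-complement {suc n} f with f zero
... | true  = cong suc (count-complement (λ i → f (suc i)))
... | false = trans (+-suc _ _) (cong suc (count-complement (λ i → f (suc i))))

not≡true⇒≡false : ∀ {b} → not b ≡ true → b ≡ false
not≡true⇒≡false {false} _ = refl

count≡n⇒all : ∀ {n} (f : Fin n → Bool) → count f ≡ n → ∀ y → f y ≡ true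
count≡n⇒all {suc n} f c≡n y with f zero in f0
count≡n⇒all {suc n} f c≡n zero    | true  = f0
count≡n⇒all {suc n} f c≡n (suc y) | true  = count≡n⇒all (λ i → f (suc i)) (suc-injective c≡n) y
... | false = ⊥-elim (1+n≰n (subst (_≤ n) c≡n (count≤n (λ i → f (suc i)))))

count>0⇒witness : ∀ {n} (f : Fin n → Bool) → 0 < count f → ∃ λ x → f x ≡ true
count>0⇒witness {suc n} f c>0 with f zero in f0
... | true  = zero , f0
... | false with count>0⇒witness (λ i → f (suc i)) c>0
...   | x , fx = suc x , fx

disjoint-complement : ∀ {n} (f g : Fin n → Bool) → (∀ y → f y ∧ g y ≡ false) →
  count f + count g ≡ n → ∀ y → f y ≡ not (g y)
disjoint-complement {n} f g disjoint f+g≡n y = complementary (f y) (g y) (disjoint y) (covered y)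
  where
  no-common-elements : count (λ y → f y ∧ g y) ≡ 0
  no-common-elements = n≤0⇒n≡0 (≤-trans (count-mono _ (λ _ → false) (λ y p → trans (sym (disjoint y)) p))
                                (≤-reflexive (sum-replicate-zero n)))
  covered : ∀ y → f y ∨ g y ≡ true
  covered = count≡n⇒all (λ y → f y ∨ g y) (begin
    count (λ y → f y ∨ g y)                                 ≡⟨ +-identityʳ _ ⟨
    count (λ y → f y ∨ g y) + 0                             ≡⟨ cong (count (λ y → f y ∨ g y) +_) no-common-elements ⟨
    count (λ y → f y ∨ g y) + count (λ y → f y ∧ g y)       ≡⟨ count-∨-∧ f g ⟨
    count f + count g                                       ≡⟨ f+g≡n ⟩
    n                                                       ∎)
    where open ≡-Reasoning
  complementary : ∀ b c → b ∧ c ≡ false → b ∨ c ≡ true → b ≡ not c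
  complementary true  false _ _ = refl
  complementary false true  _ _ = refl

overlapping : ∀ {n} (f g h : Fin n → Bool) → (∀ y → f y ≡ true → h y ≡ true) → (∀ y → g y ≡ true → h y ≡ true) →
  count h < count f + count g → ∃ λ y → f y ≡ true × g y ≡ true
overlapping f g h f⊆h g⊆h h<f+g = map₂ ∧-true (count>0⇒witness (λ y → f y ∧ g y) positive)
  where
  f∨g⊆h : ∀ y → f y ∨ g y ≡ true → h y ≡ true
  f∨g⊆h y with f y in fy | g y in gy
  ... | true  | _    = λ _ → f⊆h y fy
  ... | false | true = λ _ → g⊆h y gy
  positive : 0 < count (λ y → f y ∧ g y)
  positive = +-cancelˡ-< (count (λ y → f y ∨ g y)) 0 _ (begin-strict
    count (λ y → f y ∨ g y) + 0                         ≡⟨ +-identityʳ _ ⟩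
    count (λ y → f y ∨ g y)                             ≤⟨ count-mono _ h f∨g⊆h ⟩
    count h                                             <⟨ h<f+g ⟩
    count f + count g                                   ≡⟨ count-∨-∧ f g ⟩
    count (λ y → f y ∨ g y) + count (λ y → f y ∧ g y)   ∎)
    where open ≤-Reasoning
  ∧-true : ∀ {b c} → b ∧ c ≡ true → b ≡ true × c ≡ true
  ∧-true {true} {true} _ = refl , refl

does-sound : ∀ {p} {P : Set p} (d : Dec P) → does d ≡ true → P
does-sound (yes p) _ = p

module _ {m : ℕ} where
  private
    N : ℕ
    N = suc m

  sum-representation? : (U V : Subset N) (x : Fin N) →
    Dec (∃ λ u → ∃ λ v → (u ∈ U × v ∈ V) × x ≡ u ⊕ v)
  sum-representation? U V x = any? λ u → any? λ v → (u ∈? U ×-dec v ∈? V) ×-dec (x ≟ᶠ (u ⊕ v))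

  ∈-sumset : (U V : Subset N) (u v : Fin N) → lookup U u ≡ true → lookup V v ≡ true →
    lookup (sumset U V) (u ⊕ v) ≡ true
  ∈-sumset U V u v u∈U v∈V =
    trans (lookup∘tabulate (λ x → does (sum-representation? U V x)) (u ⊕ v))
          (dec-true (sum-representation? U V (u ⊕ v)) (u , v , (lookup⇒[]= u U u∈U , lookup⇒[]= v V v∈V) , refl))

  sumset-∈ : (U V : Subset N) (x : Fin N) → lookup (sumset U V) x ≡ true →
    ∃ λ u → ∃ λ v → lookup U u ≡ true × lookup V v ≡ true × x ≡ u ⊕ v
  sumset-∈ U V x x∈U+V with does-sound (sum-representation? U V x)
                               (trans (sym (lookup∘tabulate (λ x → does (sum-representation? U V x)) x)) x∈U+V)
  ... | u , v , (u∈U , v∈V) , x≡u⊕v = u , v , []=⇒lookup u∈U , []=⇒lookup v∈V , x≡u⊕v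

  Period : (Fin N → Bool) → Fin N → Set
  Period S t = ∀ z → S z ≡ S (z ⊕ t)

  -- The periods as a Boolean predicate, so that they can be counted.
  periods : (Fin N → Bool) → Fin N → Bool
  periods S t = does (all? λ z → S z ≟ᵇ S (z ⊕ t))

  period→periods : (S : Fin N → Bool) (t : Fin N) → Period S t → periods S t ≡ true
  period→periods S t = dec-true (all? λ z → S z ≟ᵇ S (z ⊕ t))

  periods→period : (S : Fin N → Bool) (t : Fin N) → periods S t ≡ true → Period S t
  periods→period S t = does-sound (all? λ z → S z ≟ᵇ S (z ⊕ t))

  count-translate : (f : Fin N → Bool) (c : Fin N) → count (λ y → f (y ⊖ c)) ≡ count f
  count-translate f c = count-permute f (_⊖ c) (_⊕ c) (λ y → ⊕-⊖ y c) (λ x → ⊖-⊕ x c)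

  translate-embed : (f g : Fin N → Bool) (c : Fin N) → (∀ x → f x ≡ true → g (x ⊖ c) ≡ true) →
    count f ≤ count g
  translate-embed f g c = count-embed f g (_⊖ c) (_⊕ c) (λ y → ⊕-⊖ y c) (λ x → ⊖-⊕ x c)

  period-⊖ : (S : Fin N → Bool) (t t′ : Fin N) → Period S t → Period S t′ → Period S (t ⊖ t′)
  period-⊖ S t t′ per-t per-t′ z = sym (begin
    S (z ⊕ (t ⊖ t′))          ≡⟨ per-t′ (z ⊕ (t ⊖ t′)) ⟩
    S ((z ⊕ (t ⊖ t′)) ⊕ t′)   ≡⟨ cong S (trans (⊕-assoc z (t ⊖ t′) t′) (cong (z ⊕_) (⊖-⊕ t t′))) ⟩
    S (z ⊕ t)                 ≡⟨ per-t z ⟨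
    S z                       ∎)
    where open ≡-Reasoning

  coset-⊆ : (S : Fin N → Bool) (a y : Fin N) → S a ≡ true → Period S (y ⊖ a) → S y ≡ true
  coset-⊆ S a y a∈S per = trans (cong S (sym (⊕-⊖′ y a))) (trans (sym (per a)) a∈S)

  -- If the periods of S make up more than half of |S|, then all differences of elements of S are
  -- periods: the cosets a + periods and a′ + periods both lie in S, so they meet.
  differences-are-periods : (S : Fin N → Bool) (a a′ : Fin N) → S a ≡ true → S a′ ≡ true →
    count S < count (periods S) + count (periods S) → Period S (a′ ⊖ a)
  differences-are-periods S a a′ a∈S a′∈S large =
    meet (overlapping (coset a) (coset a′) S (coset⊆S a a∈S) (coset⊆S a′ a′∈S) cosets-large)
    where
    coset : Fin N → Fin N → Bool
    coset b y = periods S (y ⊖ b)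
    coset⊆S : ∀ b → S b ≡ true → ∀ y → coset b y ≡ true → S y ≡ true
    coset⊆S b b∈S y y∈coset = coset-⊆ S b y b∈S (periods→period S (y ⊖ b) y∈coset)
    cosets-large : count S < count (coset a) + count (coset a′)
    cosets-large = subst₂ (λ p p′ → count S < p + p′)
      (sym (count-translate (periods S) a)) (sym (count-translate (periods S) a′)) large
    meet : (∃ λ y → coset a y ≡ true × coset a′ y ≡ true) → Period S (a′ ⊖ a)
    meet (y , y⊖a-period , y⊖a′-period) = subst (Period S) (⊖-⊖-cancel y a a′)
      (period-⊖ S (y ⊖ a) (y ⊖ a′) (periods→period S (y ⊖ a) y⊖a-period) (periods→period S (y ⊖ a′) y⊖a′-period))

  -- If every difference of elements of A is a period, then A + A = A + a for any a ∈ A,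
  -- so |A + A| ≤ |A|.
  sumset-absorbed : (A : Subset N) (a : Fin N) → lookup A a ≡ true →
    (∀ a′ → lookup A a′ ≡ true → Period (lookup A) (a′ ⊖ a)) →
    count (lookup (sumset A A)) ≤ count (lookup A)
  sumset-absorbed A a a∈A diff-period = translate-embed (lookup (sumset A A)) (lookup A) a shifted-into-A
    where
    sum-shifted-into-A : ∀ u v → lookup A u ≡ true → lookup A v ≡ true → lookup A ((u ⊕ v) ⊖ a) ≡ true
    sum-shifted-into-A u v u∈A v∈A =
      trans (cong (lookup A) (⊕-⊖-assoc u v a)) (trans (sym (diff-period v v∈A u)) u∈A)
    shifted-into-A : ∀ g → lookup (sumset A A) g ≡ true → lookup A (g ⊖ a) ≡ true
    shifted-into-A g g∈A+A with sumset-∈ A A g g∈A+A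
    ... | u , v , u∈A , v∈A , g≡u⊕v =
      subst (λ h → lookup A (h ⊖ a) ≡ true) (sym g≡u⊕v) (sum-shifted-into-A u v u∈A v∈A)

  non-sum-complement : (A B : Subset N) → count (lookup A) + count (lookup B) ≡ N →
    (x : Fin N) → lookup (sumset A B) x ≡ false → ∀ y → lookup B y ≡ not (lookup A (x ⊖ y))
  non-sum-complement A B |A|+|B|≡N x x∉A+B =
    disjoint-complement (lookup B) reflected disjoint (begin
      count (lookup B) + count reflected   ≡⟨ cong (count (lookup B) +_) reflected-count ⟩
      count (lookup B) + count (lookup A)  ≡⟨ +-comm (count (lookup B)) (count (lookup A)) ⟩
      count (lookup A) + count (lookup B)  ≡⟨ |A|+|B|≡N ⟩
      N                                    ∎)
    where
    open ≡-Reasoning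
    reflected : Fin N → Bool
    reflected y = lookup A (x ⊖ y)
    reflected-count : count reflected ≡ count (lookup A)
    reflected-count = count-permute (lookup A) (x ⊖_) (x ⊖_) (⊖-involutive x) (⊖-involutive x)
    disjoint : ∀ y → lookup B y ∧ reflected y ≡ false
    disjoint y with lookup B y in y∈B | reflected y in x−y∈A
    ... | false | _     = refl
    ... | true  | false = refl
    ... | true  | true  with () ← trans (sym (trans (cong (lookup (sumset A B)) (sym (⊖-⊕ x y)))
                                                    (∈-sumset A B (x ⊖ y) y x−y∈A y∈B))) x∉A+B

  -- Two non-sums x, x₀ ∉ A + B give the same reflection x − A = x₀ − A,
  -- so x ⊖ x₀ is a period of A.
  non-sums-differ-by-periods : (A B : Subset N) → count (lookup A) + count (lookup B) ≡ N →
    (x x₀ : Fin N) → lookup (sumset A B) x ≡ false → lookup (sumset A B) x₀ ≡ false →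
    Period (lookup A) (x ⊖ x₀)
  non-sums-differ-by-periods A B |A|+|B|≡N x x₀ x∉A+B x₀∉A+B z = begin
    lookup A z                   ≡⟨ cong (lookup A) (⊖-involutive x₀ z) ⟨
    lookup A (x₀ ⊖ (x₀ ⊖ z))     ≡⟨ not-injective {lookup A (x₀ ⊖ (x₀ ⊖ z))} {lookup A (x ⊖ (x₀ ⊖ z))}
                                      (trans (sym (complement x₀ x₀∉A+B (x₀ ⊖ z))) (complement x x∉A+B (x₀ ⊖ z))) ⟩
    lookup A (x ⊖ (x₀ ⊖ z))      ≡⟨ cong (lookup A) (⊖-⊖-shift x x₀ z) ⟩
    lookup A (z ⊕ (x ⊖ x₀))      ∎
    where
    open ≡-Reasoning
    complement : (x : Fin N) → lookup (sumset A B) x ≡ false → ∀ y → lookup B y ≡ not (lookup A (x ⊖ y))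
    complement = non-sum-complement A B |A|+|B|≡N

  non-sums≤periods : (A B : Subset N) → count (lookup A) + count (lookup B) ≡ N →
    (x₀ : Fin N) → lookup (sumset A B) x₀ ≡ false →
    count (λ x → not (lookup (sumset A B) x)) ≤ count (periods (lookup A))
  non-sums≤periods A B |A|+|B|≡N x₀ x₀∉A+B =
    translate-embed (λ x → not (lookup (sumset A B) x)) (periods (lookup A)) x₀ λ x x∉A+B →
      period→periods (lookup A) (x ⊖ x₀)
        (non-sums-differ-by-periods A B |A|+|B|≡N x x₀ (not≡true⇒≡false x∉A+B) x₀∉A+B)

few-sums⇒many-non-sums : ∀ k s M → s + M ≡ k + k → 2 * s < 3 * k → k < M + M
few-sums⇒many-non-sums k s M s+M≡2k 2s<3k = +-cancelˡ-≤ (2 * s) (suc k) (M + M) (begin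
  2 * s + suc k        ≡⟨ +-suc (2 * s) k ⟩
  suc (2 * s) + k      ≤⟨ +-monoˡ-≤ k 2s<3k ⟩
  3 * k + k            ≡⟨ solve 1 (λ k → con 3 :* k :+ k := (k :+ k) :+ (k :+ k)) refl k ⟩
  (k + k) + (k + k)    ≡⟨ cong₂ _+_ s+M≡2k s+M≡2k ⟨
  (s + M) + (s + M)    ≡⟨ solve 2 (λ s M → (s :+ M) :+ (s :+ M) := con 2 :* s :+ (M :+ M)) refl s M ⟩
  2 * s + (M + M)      ∎)
  where
  open ≤-Reasoning
  open +-*-Solver

n<M+M⇒0<M : ∀ {n M} → n < M + M → 0 < M
n<M+M⇒0<M {M = suc _} _ = s≤s z≤n

-- Arithmetic: 3k ≤ 2s implies 2k² ≤ s², since (3/2)² ≥ 2; this is how √2·k is reached over ℕ.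
three-halves⇒√2 : ∀ k s → 3 * k ≤ 2 * s → 2 * k * k ≤ s * s
three-halves⇒√2 k s 3k≤2s = *-cancelˡ-≤ 4 (begin
  4 * (2 * k * k)      ≡⟨ solve 1 (λ k → con 4 :* (con 2 :* k :* k) := con 8 :* (k :* k)) refl k ⟩
  8 * (k * k)          ≤⟨ *-monoˡ-≤ (k * k) {8} {9} (n≤1+n 8) ⟩
  9 * (k * k)          ≡⟨ solve 1 (λ k → con 9 :* (k :* k) := (con 3 :* k) :* (con 3 :* k)) refl k ⟩
  (3 * k) * (3 * k)    ≤⟨ *-mono-≤ 3k≤2s 3k≤2s ⟩
  (2 * s) * (2 * s)    ≡⟨ solve 1 (λ s → (con 2 :* s) :* (con 2 :* s) := con 4 :* (s :* s)) refl s ⟩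
  4 * (s * s)          ∎)
  where
  open ≤-Reasoning
  open +-*-Solver

sumset-lower-bound : ∀ {m} k (A B : Subset (suc m)) → suc m ≡ k + k → 1 ≤ k →
  ∣ A ∣ ≡ k → ∣ B ∣ ≡ k → ∣ sumset A A ∣ ≡ suc m → 3 * k ≤ 2 * ∣ sumset A B ∣
sumset-lower-bound {m} k A B N≡2k k≥1 |A|≡k |B|≡k |A+A|≡N with 3 * k ≤? 2 * ∣ sumset A B ∣
... | yes bound = bound
... | no ¬bound = ⊥-elim (<⇒≱ (m<m+n k k≥1) (begin
  k + k                          ≡⟨ trans (sym N≡2k) (trans (sym |A+A|≡N) (∣∣≡count (sumset A A))) ⟩
  count (lookup (sumset A A))    ≤⟨ sumset-absorbed A a a∈A (λ a′ a′∈A →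
                                      differences-are-periods (lookup A) a a′ a∈A a′∈A many-periods) ⟩
  count (lookup A)               ≡⟨ countA≡k ⟩
  k                              ∎))
  where
  open ≤-Reasoning
  countA≡k : count (lookup A) ≡ k
  countA≡k = trans (sym (∣∣≡count A)) |A|≡k
  |A|+|B|≡N : count (lookup A) + count (lookup B) ≡ suc m
  |A|+|B|≡N = trans (cong₂ _+_ countA≡k (trans (sym (∣∣≡count B)) |B|≡k)) (sym N≡2k)
  element-of-A : ∃ λ a → lookup A a ≡ true
  element-of-A = count>0⇒witness (lookup A) (subst (0 <_) (sym countA≡k) k≥1)
  a : Fin (suc m)
  a = proj₁ element-of-A
  a∈A : lookup A a ≡ true
  a∈A = proj₂ element-of-A
  non-sums : Fin (suc m) → Bool
  non-sums x = not (lookup (sumset A B) x)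
  many-non-sums : k < count non-sums + count non-sums
  many-non-sums = few-sums⇒many-non-sums k ∣ sumset A B ∣ (count non-sums)
    (trans (cong (_+ count non-sums) (∣∣≡count (sumset A B)))
           (trans (count-complement (lookup (sumset A B))) N≡2k))
    (≰⇒> ¬bound)
  non-sum : ∃ λ x₀ → non-sums x₀ ≡ true
  non-sum = count>0⇒witness non-sums (n<M+M⇒0<M many-non-sums)
  non-sums≤periods-of-A : count non-sums ≤ count (periods (lookup A))
  non-sums≤periods-of-A = non-sums≤periods A B |A|+|B|≡N (proj₁ non-sum) (not≡true⇒≡false (proj₂ non-sum))
  many-periods : count (lookup A) < count (periods (lookup A)) + count (periods (lookup A))
  many-periods = subst (_< _) (sym countA≡k)
    (≤-trans many-non-sums (+-mono-≤ non-sums≤periods-of-A non-sums≤periods-of-A))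

mainTheorem1 : (k : ℕ) → 1 ≤ k → (A B : Subset (2 * k)) →
    ∣ A ∣ ≡ k → ∣ B ∣ ≡ k → ∣ sumset A A ∣ ≡ 2 * k →
    2 * k * k ≤ (∣ sumset A B ∣ ⊔ ∣ diffset A B ∣) * (∣ sumset A B ∣ ⊔ ∣ diffset A B ∣)
mainTheorem1 zero () A B |A|≡k |B|≡k |A+A|≡2k
mainTheorem1 k@(suc _) k≥1 A B |A|≡k |B|≡k |A+A|≡2k = begin
  2 * k * k    ≤⟨ three-halves⇒√2 k s sum-bound ⟩
  s * s        ≤⟨ *-mono-≤ (m≤m⊔n s d) (m≤m⊔n s d) ⟩
  (s ⊔ d) * (s ⊔ d) ∎
  where
  open ≤-Reasoning
  s d : ℕ
  s = ∣ sumset A B ∣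
  d = ∣ diffset A B ∣
  sum-bound : 3 * k ≤ 2 * s
  sum-bound = sumset-lower-bound k A B (cong (k +_) (+-identityʳ k)) k≥1 |A|≡k |B|≡k |A+A|≡2k
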